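{- Let $S$ be an association scheme on a finite set $X$, let $T$ be a thin association scheme on a finite set $Y$, and let $\phi$ be a morphism from $S$ to $T$. Define linear maps $\rho_S:\mathcal A(S)\to\mathcal A(T)\otimes\mathcal A(S)$ and $\varepsilon_S:\mathcal A(S)\to\mathcal A(T)$ by $\rho_S(\sigma_p)=\sigma_{\phi(p)}\otimes\sigma_p$ and $\varepsilon_S(\sigma_p)=n_p\sigma_{\phi(p)}$ for $p\in S$. Then $\varepsilon_S$ is an algebra homomorphism, and $\rho_S$ makes $\mathcal A(S)$ a left $\mathcal A(T)$-comodule algebra.
   Context: An association scheme on a finite set $X$ is a partition $S$ of $X\times X$ into nonempty subsets such that $1_X=\{(x,x)\}\in S$; $s^*=\{(x,y):(y,x)\in s\}\in S$; and for $p,q,r\in S$ there is $a_{pq}^r\ge0$ with $|\{y:(x,y)\in p,(y,z)\in q\}|=a_{pq}^r$ whenever $(x,z)\in r$. The valency $n_s=|\{y:(x,y)\in s\}|$ (independent of $x$); a scheme is thin if all valencies are $1$. A morphism from $S$ on $X$ to $T$ on $Y$ is a function $\phi:X\cup S\to Y\cup T$ with $\phi(X)\subseteq Y$, $\phi(S)\subseteq T$ and $(\phi(x_1),\phi(x_2))\in\phi(s)$ whenever $(x_1,x_2)\in s$. $\sigma_s$ is the $X\times X$ 0/1 complex matrix with $(x,y)$-entry $1$ iff $(x,y)\in s$, and $\mathcal A(S)$ is the algebra spanned by the $\sigma_s$. For thin $T$, $\mathcal A(T)$ is the Hopf algebra with comultiplication $\Delta_T(\sigma_t)=\sigma_t\otimes\sigma_t$,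 counit $\varepsilon_T(\sigma_t)=1$, antipode $\sigma_t\mapsto\sigma_{t^*}$. For a Hopf algebra $A$ with comultiplication $\Delta_A$ and counit $\varepsilon_A$, a left $A$-comodule algebra is a unital algebra $M$ with an algebra homomorphism $\rho_M:M\to A\otimes M$ such that $(\mathrm{id}_A\otimes\rho_M)\circ\rho_M=(\Delta_A\otimes\mathrm{id}_M)\circ\rho_M$ and $(\varepsilon_A\otimes\mathrm{id}_M)(\rho_M(m))=1\otimes m$ for all $m\in M$. -}

module Defs where

open import Level using (Level)
open import Data.Nat using (ℕ; zero; suc) renaming (_+_ to _+ℕ_)
open import Data.Fin using (Fin; zero; suc)
open import Data.Fin.Properties using (_≟_)
open import Data.Bool using (Bool; true; false; if_then_else_; _∧_)
open import Data.Product using (_×_; _,_; proj₁; ∃₂)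
open import Relation.Nullary.Decidable using (⌊_⌋)
open import Relation.Binary.PropositionalEquality using (_≡_)
open import Algebra.Bundles using (CommutativeRing)

countF : ∀ {n} → (Fin n → Bool) → ℕ
countF {zero} f = 0
countF {suc n} f = (if f zero then 1 else 0) +ℕ countF (λ i → f (suc i))

-- An association scheme on X = Fin n whose relations are indexed by Fin k.
-- rel x y is the (unique) relation s ∈ S with (x,y) ∈ s; thus the classes
-- {(x,y) : rel x y ≡ s} partition X × X.
record Scheme (n k : ℕ) : Set where
  field
    rel      : Fin n → Fin n → Fin k
    nonempty : ∀ s → ∃₂ λ x y → rel x y ≡ s
    one      : Fin k
    one-spec : ∀ x y → (rel x y ≡ one → x ≡ y) × (x ≡ y → rel x y ≡ one)
    star     : Fin k → Fin k
    star-spec : ∀ s x y → (rel x y ≡ star s → rel y x ≡ s) × (rel y x ≡ s → rel x y ≡ star s)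
    a        : Fin k → Fin k → Fin k → ℕ
    a-spec   : ∀ p q x z →
               countF (λ y → ⌊ rel x y ≟ p ⌋ ∧ ⌊ rel y z ≟ q ⌋) ≡ a p q (rel x z)

open Scheme public

-- valency n_s = |{y : (x,y) ∈ s}|, computed at a point x with some (x,y) ∈ s
valency : ∀ {n k} → Scheme n k → Fin k → ℕ
valency S s = countF (λ y → ⌊ rel S (proj₁ (Scheme.nonempty S s)) y ≟ s ⌋)

IsThin : ∀ {n k} → Scheme n k → Set
IsThin {k = k} S = ∀ (s : Fin k) → valency S s ≡ 1

record Morphism {n k m l} (S : Scheme n k) (T : Scheme m l) : Set where
  field
    mapX : Fin n → Fin m
    mapS : Fin k → Fin l
    hom  : ∀ x₁ x₂ → rel T (mapX x₁) (mapX x₂) ≡ mapS (rel S x₁ x₂)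

open Morphism public

module OverRing {c ℓ : Level} (R : CommutativeRing c ℓ) where
  open CommutativeRing R using (Carrier; _≈_; _+_; _*_; 0#; 1#)

  ∑ : ∀ {n} → (Fin n → Carrier) → Carrier
  ∑ {zero} f = 0#
  ∑ {suc n} f = f zero + ∑ (λ i → f (suc i))

  nat : ℕ → Carrier
  nat zero = 0#
  nat (suc n) = 1# + nat n

  δ : ∀ {k} → Fin k → Fin k → Carrier
  δ i j = if ⌊ i ≟ j ⌋ then 1# else 0#

  Mat : ℕ → Set c
  Mat n = Fin n → Fin n → Carrier

  _⊙_ : ∀ {n} → Mat n → Mat n → Mat n
  (A ⊙ B) x z = ∑ (λ y → A x y * B y z)

  idMat : ∀ {n} → Mat n
  idMat x y = δ x y

  _≈M_ : ∀ {n} → Mat n → Mat n → Set ℓ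
  A ≈M B = ∀ x y → A x y ≈ B x y

  Mat₂ : ℕ → ℕ → Set c
  Mat₂ m n = (Fin m × Fin n) → (Fin m × Fin n) → Carrier

  _⊙₂_ : ∀ {m n} → Mat₂ m n → Mat₂ m n → Mat₂ m n
  (A ⊙₂ B) u w = ∑ (λ y → ∑ (λ x → A u (y , x) * B (y , x) w))

  idMat₂ : ∀ {m n} → Mat₂ m n
  idMat₂ (y , x) (y' , x') = δ y y' * δ x x'

  _≈M₂_ : ∀ {m n} → Mat₂ m n → Mat₂ m n → Set ℓ
  A ≈M₂ B = ∀ u w → A u w ≈ B u w

  -- Elements of A(S) given by coordinates w.r.t. the basis (σ_s)_{s ∈ S};
  -- elements of A(T) ⊗ A(S) w.r.t. the basis (σ_t ⊗ σ_s), etc.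
  A[_] : ∀ {n k} → Scheme n k → Set c
  A[_] {k = k} S = Fin k → Carrier

  A[_⊗_] : ∀ {m l n k} → Scheme m l → Scheme n k → Set c
  A[_⊗_] {l = l} {k = k} T S = Fin l → Fin k → Carrier

  A[_⊗_⊗_] : ∀ {m l n k} → Scheme m l → Scheme m l → Scheme n k → Set c
  A[_⊗_⊗_] {l = l} {k = k} T T' S = Fin l → Fin l → Fin k → Carrier

  -- the matrix Σ_s c_s σ_s
  mat : ∀ {n k} (S : Scheme n k) → A[ S ] → Mat n
  mat S c x y = c (rel S x y)

  -- the matrix Σ_{t,s} d_{t,s} (σ_t ⊗ σ_s) (Kronecker product)
  mat₂ : ∀ {m l n k} (T : Scheme m l) (S : Scheme n k) → A[ T ⊗ S ] → Mat₂ m n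
  mat₂ T S d (y , x) (y' , x') = d (rel T y y') (rel S x x')

  module _ {n k m l} {S : Scheme n k} {T : Scheme m l} (φ : Morphism S T) where

    -- ρ_S(σ_p) = σ_{φ(p)} ⊗ σ_p
    ρ : A[ S ] → A[ T ⊗ S ]
    ρ c t p = δ (mapS φ p) t * c p

    -- ε_S(σ_p) = n_p σ_{φ(p)}
    ε : A[ S ] → A[ T ]
    ε c t = ∑ (λ p → δ (mapS φ p) t * (nat (valency S p) * c p))

    id⊗ρ : A[ T ⊗ S ] → A[ T ⊗ T ⊗ S ]
    id⊗ρ d t t' p = d t p * δ (mapS φ p) t'

  -- Δ_T ⊗ id, with Δ_T(σ_t) = σ_t ⊗ σ_t
  Δ⊗id : ∀ {m l n k} {T : Scheme m l} {S : Scheme n k} → A[ T ⊗ S ] → A[ T ⊗ T ⊗ S ]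
  Δ⊗id d t t' p = δ t t' * d t p

  -- ε_T ⊗ id : A(T) ⊗ A(S) → ℂ ⊗ A(S) ≅ A(S), with ε_T(σ_t) = 1
  εT⊗id : ∀ {m l n k} {T : Scheme m l} {S : Scheme n k} → A[ T ⊗ S ] → A[ S ]
  εT⊗id d p = ∑ (λ t → d t p)

  -- 1 ⊗ m, identified with m under ℂ ⊗ A(S) ≅ A(S)
  -- f : A(S) → A(T) is a unital algebra homomorphism (f linear by construction)
  IsAlgHom : ∀ {n k m l} (S : Scheme n k) (T : Scheme m l) → (A[ S ] → A[ T ]) → Set (c Level.⊔ ℓ)
  IsAlgHom S T f =
    (∀ a b e → (mat S a ⊙ mat S b) ≈M mat S e →
               (mat T (f a) ⊙ mat T (f b)) ≈M mat T (f e))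
    × (∀ e → mat S e ≈M idMat → mat T (f e) ≈M idMat)

  IsAlgHom₂ : ∀ {n k m l} (S : Scheme n k) (T : Scheme m l) → (A[ S ] → A[ T ⊗ S ]) → Set (c Level.⊔ ℓ)
  IsAlgHom₂ S T f =
    (∀ a b e → (mat S a ⊙ mat S b) ≈M mat S e →
               (mat₂ T S (f a) ⊙₂ mat₂ T S (f b)) ≈M₂ mat₂ T S (f e))
    × (∀ e → mat S e ≈M idMat → mat₂ T S (f e) ≈M₂ idMat₂)

  IsComoduleAlgebra : ∀ {n k m l} {S : Scheme n k} {T : Scheme m l} → Morphism S T → Set (c Level.⊔ ℓ)
  IsComoduleAlgebra {S = S} {T = T} φ =
    IsAlgHom₂ S T (ρ φ)
    × (∀ e t t' p → id⊗ρ φ (ρ φ e) t t' p ≈ Δ⊗id {T = T} {S = S} (ρ φ e) t t' p)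
    × (∀ e p → εT⊗id {T = T} {S = S} (ρ φ e) p ≈ e p)

module Submission where

-- Writing Φ((y,x),(y',x')) for the
-- indicator of φ(rel(x,x')) = rel(y,y'), the matrix of ρ_S(c) is the entrywise
-- product of Φ with the matrix of c.  The heart of the proof is that Φ is
-- "idempotent along paths": Σ_{y'} Φ((y,x),(y',z)) Φ((y',z),(y'',x')) =
-- Φ((y,x),(y'',x')).  This follows from thinness of T: each y has exactly one
-- t-successor, and the relation between the ends of a two-step path in T only
-- depends on the relations of the steps.  For ε_S we first show (using that valencies do not
-- depend on the base point) that each entry of ε_S(c) is a row sum of the
-- matrix of ρ_S(c) taken at an arbitrary base point x ∈ X; multiplicativity
-- and unitality of ε_S are thereby inherited from those of ρ_S.
-- Coassociativity and the counit law are identities between Kronecker deltas.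

open import Defs
open import Level using (Level)
open import Data.Nat using (ℕ)
open import Data.Product using (_×_)
open import Algebra.Bundles using (CommutativeRing)

open import Data.Nat using (zero; suc; _≤_; z≤n; s≤s) renaming (_+_ to _+ℕ_)
open import Data.Nat.Properties using (suc-injective)
open import Data.Fin using (Fin; zero; suc)
open import Data.Fin.Properties using (_≟_) renaming (suc-injective to Fin-suc-injective)
open import Data.Bool using (Bool; true; false; if_then_else_; _∧_)
open import Data.Product using (∃; _,_; proj₁; proj₂)
import Data.Product as Product
open import Relation.Nullary using (Dec; yes; no; ¬_; contradiction)
open import Relation.Nullary.Decidable using (⌊_⌋; isYes≗does; dec-true; dec-false)
open import Relation.Binary.PropositionalEquality as ≡ using (_≡_; _≢_; refl; cong; cong₂)
open import Function using (_∘_; id)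
import Algebra.Properties.CommutativeSemigroup as CommSemigroupProperties
import Algebra.Properties.Semiring.Sum as SemiringSum

⌊⌋-true : ∀ {p} {A : Set p} (d : Dec A) → A → ⌊ d ⌋ ≡ true
⌊⌋-true d a = ≡.trans (isYes≗does d) (dec-true d a)

⌊⌋-false : ∀ {p} {A : Set p} (d : Dec A) → ¬ A → ⌊ d ⌋ ≡ false
⌊⌋-false d ¬a = ≡.trans (isYes≗does d) (dec-false d ¬a)

⌊⌋-sound : ∀ {p} {A : Set p} (d : Dec A) → ⌊ d ⌋ ≡ true → A
⌊⌋-sound (yes a) _ = a

∧-redundant : ∀ (b c : Bool) → (b ≡ true → c ≡ true) → b ≡ b ∧ c
∧-redundant true c b⇒c = ≡.sym (b⇒c refl)
∧-redundant false c _ = refl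

∧-split : ∀ (b c : Bool) → b ∧ c ≡ true → (b ≡ true) × (c ≡ true)
∧-split true true _ = refl , refl

countF-cong : ∀ {n} {f g : Fin n → Bool} → (∀ i → f i ≡ g i) → countF f ≡ countF g
countF-cong {zero} f≗g = refl
countF-cong {suc n} f≗g =
  cong₂ (λ b r → (if b then 1 else 0) +ℕ r) (f≗g zero) (countF-cong (f≗g ∘ suc))

witness⇒count : ∀ {n} (f : Fin n → Bool) (i : Fin n) → f i ≡ true → 1 ≤ countF f
witness⇒count f zero fi with f zero
... | true = s≤s z≤n
witness⇒count f (suc i) fi with f zero
... | true = s≤s z≤n
... | false = witness⇒count (f ∘ suc) i fi

count⇒witness : ∀ {n} (f : Fin n → Bool) → 1 ≤ countF f → ∃ λ i → f i ≡ true
count⇒witness {suc n} f pos with f zero in f₀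
... | true = zero , f₀
... | false = Product.map suc id (count⇒witness (f ∘ suc) pos)

count-one-unique : ∀ {n} (f : Fin n → Bool) {i j : Fin n} →
                   countF f ≡ 1 → f i ≡ true → f j ≡ true → i ≡ j
count-one-unique {suc n} f {i} {j} one fi fj with f zero in f₀
count-one-unique {suc n} f {zero} {zero} one fi fj | _ = refl
count-one-unique {suc n} f {zero} {suc j} one fi fj | true =
  contradiction (≡.subst (1 ≤_) (suc-injective one) (witness⇒count (f ∘ suc) j fj)) λ ()
count-one-unique {suc n} f {suc i} {_} one fi fj | true =
  contradiction (≡.subst (1 ≤_) (suc-injective one) (witness⇒count (f ∘ suc) i fi)) λ ()
count-one-unique {suc n} f {zero} {_} one fi fj | false = contradiction (≡.trans (≡.sym fi) f₀) λ ()
count-one-unique {suc n} f {suc i} {zero} one fi fj | false = contradiction (≡.trans (≡.sym fj) f₀) λ ()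
count-one-unique {suc n} f {suc i} {suc j} one fi fj | false = cong suc (count-one-unique (f ∘ suc) one fi fj)

module SchemeFacts {n k} (S : Scheme n k) where

  rel-flip : ∀ u v → rel S v u ≡ star S (rel S u v)
  rel-flip u v = proj₂ (star-spec S (rel S u v) v u) refl

  -- The number of p-successors of x is the intersection number a_{p p*}^{1},
  -- since y is a p-successor of x iff x is a p*-successor of y.
  successors≡a : ∀ x p → countF (λ y → ⌊ rel S x y ≟ p ⌋) ≡ a S p (star S p) (one S)
  successors≡a x p = begin
    countF (λ y → ⌊ rel S x y ≟ p ⌋)
      ≡⟨ countF-cong (λ y → ∧-redundant _ _ (back y)) ⟩
    countF (λ y → ⌊ rel S x y ≟ p ⌋ ∧ ⌊ rel S y x ≟ star S p ⌋)
      ≡⟨ a-spec S p (star S p) x x ⟩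
    a S p (star S p) (rel S x x)
      ≡⟨ cong (a S p (star S p)) (proj₂ (one-spec S x x) refl) ⟩
    a S p (star S p) (one S) ∎
    where
    open ≡.≡-Reasoning
    back : ∀ y → ⌊ rel S x y ≟ p ⌋ ≡ true → ⌊ rel S y x ≟ star S p ⌋ ≡ true
    back y xy = ⌊⌋-true (rel S y x ≟ star S p) (proj₂ (star-spec S p y x) (⌊⌋-sound (rel S x y ≟ p) xy))

  valency-at : ∀ x p → countF (λ y → ⌊ rel S x y ≟ p ⌋) ≡ valency S p
  valency-at x p = ≡.trans (successors≡a x p) (≡.sym (successors≡a (proj₁ (nonempty S p)) p))

-- Thin schemes: every relation is the graph of a permutation

module ThinFacts {m l} (T : Scheme m l) (thin : IsThin T) where
  open SchemeFacts T

  successor-count : ∀ y t → countF (λ y' → ⌊ rel T y y' ≟ t ⌋) ≡ 1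
  successor-count y t = ≡.trans (valency-at y t) (thin t)

  successor : ∀ y t → ∃ λ y' → rel T y y' ≡ t
  successor y t = Product.map id (⌊⌋-sound (rel T y _ ≟ t))
                    (count⇒witness _ (≡.subst (1 ≤_) (≡.sym (successor-count y t)) (s≤s z≤n)))

  successor-unique : ∀ {y u v} → rel T y u ≡ rel T y v → u ≡ v
  successor-unique {y} {u} {v} e =
    count-one-unique _ (successor-count y (rel T y v)) (⌊⌋-true (rel T y u ≟ _) e) (⌊⌋-true (rel T y v ≟ _) refl)

  -- The intersection number a_{t₁t₂}^{r} with
  -- r = rel(a₂,c₂) is positive (witness b₂); so at the r-successor z of a₁
  -- there is a path a₁ →t₁ w →t₂ z, and uniqueness of successors forces
  -- w = b₁ and z = c₁.
  path-rel : ∀ {a₁ b₁ c₁ a₂ b₂ c₂} → rel T a₁ b₁ ≡ rel T a₂ b₂ → rel T b₁ c₁ ≡ rel T b₂ c₂ →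
             rel T a₁ c₁ ≡ rel T a₂ c₂
  path-rel {a₁} {b₁} {c₁} {a₂} {b₂} {c₂} e₁ e₂ = ≡.subst (λ c → rel T a₁ c ≡ rel T a₂ c₂) z≡c₁ a₁z
    where
    t₁ t₂ : Fin l
    t₁ = rel T a₂ b₂
    t₂ = rel T b₂ c₂
    path : Fin m → Fin m → Fin m → Bool
    path u z w = ⌊ rel T u w ≟ t₁ ⌋ ∧ ⌊ rel T w z ≟ t₂ ⌋
    z : Fin m
    z = proj₁ (successor a₁ (rel T a₂ c₂))
    a₁z : rel T a₁ z ≡ rel T a₂ c₂
    a₁z = proj₂ (successor a₁ (rel T a₂ c₂))
    paths-equal : countF (path a₂ c₂) ≡ countF (path a₁ z)
    paths-equal = ≡.trans (a-spec T t₁ t₂ a₂ c₂) (≡.sym (≡.trans (a-spec T t₁ t₂ a₁ z) (cong (a T t₁ t₂) a₁z)))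
    middle : ∃ λ w → path a₁ z w ≡ true
    middle = count⇒witness (path a₁ z)
               (≡.subst (1 ≤_) paths-equal
                 (witness⇒count (path a₂ c₂) b₂ (cong₂ _∧_ (⌊⌋-true (t₁ ≟ t₁) refl) (⌊⌋-true (t₂ ≟ t₂) refl))))
    w : Fin m
    w = proj₁ middle
    steps : (⌊ rel T a₁ w ≟ t₁ ⌋ ≡ true) × (⌊ rel T w z ≟ t₂ ⌋ ≡ true)
    steps = ∧-split _ _ (proj₂ middle)
    w≡b₁ : w ≡ b₁
    w≡b₁ = successor-unique (≡.trans (⌊⌋-sound (_ ≟ t₁) (proj₁ steps)) (≡.sym e₁))
    z≡c₁ : z ≡ c₁
    z≡c₁ = successor-unique {b₁} (≡.trans (≡.subst (λ u → rel T u z ≡ t₂) w≡b₁ (⌊⌋-sound (_ ≟ t₂) (proj₂ steps)))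
                                          (≡.sym e₂))

module RingFacts {c ℓ : Level} (R : CommutativeRing c ℓ) where
  open CommutativeRing R renaming (refl to ≈-refl) hiding (zero)
  open OverRing R
  open SemiringSum semiring using (sum; sum-cong-≋; sum-cong-≗; ∑-comm; *-distribˡ-sum; *-distribʳ-sum; sum-replicate-zero)
  open import Relation.Binary.Reasoning.Setoid setoid

  ∑≡sum : ∀ {n} (f : Fin n → Carrier) → ∑ f ≡ sum f
  ∑≡sum {zero} f = refl
  ∑≡sum {suc n} f = cong (f zero +_) (∑≡sum (f ∘ suc))

  ∑-cong : ∀ {n} {f g : Fin n → Carrier} → (∀ i → f i ≈ g i) → ∑ f ≈ ∑ g
  ∑-cong {f = f} {g} f≈g = begin
    ∑ f   ≡⟨ ∑≡sum f ⟩
    sum f ≈⟨ sum-cong-≋ f≈g ⟩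
    sum g ≡⟨ ∑≡sum g ⟨
    ∑ g   ∎

  ∑-zero : ∀ {n} {f : Fin n → Carrier} → (∀ i → f i ≈ 0#) → ∑ f ≈ 0#
  ∑-zero {n} {f} f≈0 = begin
    ∑ f              ≈⟨ ∑-cong f≈0 ⟩
    ∑ zeros          ≡⟨ ∑≡sum zeros ⟩
    sum zeros        ≈⟨ sum-replicate-zero n ⟩
    0#               ∎
    where
    zeros : Fin n → Carrier
    zeros _ = 0#

  ∑-swap : ∀ {m n} (f : Fin m → Fin n → Carrier) → ∑ (λ i → ∑ (λ j → f i j)) ≈ ∑ (λ j → ∑ (λ i → f i j))
  ∑-swap f = begin
    ∑ (λ i → ∑ (λ j → f i j))     ≡⟨ ∑≡sum₂ f ⟩
    sum (λ i → sum (λ j → f i j)) ≈⟨ ∑-comm f ⟩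
    sum (λ j → sum (λ i → f i j)) ≡⟨ ∑≡sum₂ (λ j i → f i j) ⟨
    ∑ (λ j → ∑ (λ i → f i j))     ∎
    where
    ∑≡sum₂ : ∀ {m n} (g : Fin m → Fin n → Carrier) → ∑ (λ i → ∑ (g i)) ≡ sum (λ i → sum (g i))
    ∑≡sum₂ g = ≡.trans (∑≡sum (λ i → ∑ (g i))) (sum-cong-≗ (λ i → ∑≡sum (g i)))

  ∑-*ˡ : ∀ {n} (x : Carrier) (f : Fin n → Carrier) → x * ∑ f ≈ ∑ (λ i → x * f i)
  ∑-*ˡ x f = trans (reflexive (cong (x *_) (∑≡sum f))) (trans (*-distribˡ-sum x f) (reflexive (≡.sym (∑≡sum (λ i → x * f i)))))

  ∑-*ʳ : ∀ {n} (x : Carrier) (f : Fin n → Carrier) → ∑ f * x ≈ ∑ (λ i → f i * x)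
  ∑-*ʳ x f = trans (reflexive (cong (_* x) (∑≡sum f))) (trans (*-distribʳ-sum x f) (reflexive (≡.sym (∑≡sum (λ i → f i * x)))))

  ∑-single : ∀ {n} {f : Fin n → Carrier} (j : Fin n) → (∀ i → i ≢ j → f i ≈ 0#) → ∑ f ≈ f j
  ∑-single zero off = trans (+-congˡ (∑-zero (λ i → off (suc i) λ ()))) (+-identityʳ _)
  ∑-single (suc j) off =
    trans (+-cong (off zero λ ()) (∑-single j (λ i i≢j → off (suc i) (i≢j ∘ Fin-suc-injective)))) (+-identityˡ _)

  δ-same : ∀ {k} {i j : Fin k} → i ≡ j → δ i j ≡ 1#
  δ-same {i = i} {j} i≡j = cong (if_then 1# else 0#) (⌊⌋-true (i ≟ j) i≡j)

  δ-diff : ∀ {k} {i j : Fin k} → i ≢ j → δ i j ≡ 0#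
  δ-diff {i = i} {j} i≢j = cong (if_then 1# else 0#) (⌊⌋-false (i ≟ j) i≢j)

  δ-iff : ∀ {k k'} {i j : Fin k} {i' j' : Fin k'} → (i ≡ j → i' ≡ j') → (i' ≡ j' → i ≡ j) → δ i j ≡ δ i' j'
  δ-iff {i = i} {j} {i'} {j'} to from = by-cases (i ≟ j)
    where
    by-cases : Dec (i ≡ j) → δ i j ≡ δ i' j'
    by-cases (yes i≡j) = ≡.trans (δ-same i≡j) (≡.sym (δ-same (to i≡j)))
    by-cases (no i≢j) = ≡.trans (δ-diff i≢j) (≡.sym (δ-diff (i≢j ∘ from)))

  ∑-pickʳ : ∀ {n} (g : Fin n → Carrier) (j : Fin n) → ∑ (λ p → g p * δ j p) ≈ g j
  ∑-pickʳ g j = begin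
    ∑ (λ p → g p * δ j p) ≈⟨ ∑-single j (λ p p≢j → trans (*-congˡ (reflexive (δ-diff (p≢j ∘ ≡.sym)))) (zeroʳ _)) ⟩
    g j * δ j j           ≈⟨ *-congˡ (reflexive (δ-same refl)) ⟩
    g j * 1#              ≈⟨ *-identityʳ _ ⟩
    g j                   ∎

  ∑-pickˡ : ∀ {n} (g : Fin n → Carrier) (j : Fin n) → ∑ (λ p → δ j p * g p) ≈ g j
  ∑-pickˡ g j = trans (∑-cong (λ p → *-comm (δ j p) (g p))) (∑-pickʳ g j)

  ∑-indicator : ∀ {n} (f : Fin n → Bool) → ∑ (λ i → if f i then 1# else 0#) ≈ nat (countF f)
  ∑-indicator {zero} f = ≈-refl
  ∑-indicator {suc n} f = trans (+-congˡ (∑-indicator (f ∘ suc))) (head-term (f zero))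
    where
    head-term : ∀ b → (if b then 1# else 0#) + nat (countF (f ∘ suc)) ≈ nat ((if b then 1 else 0) +ℕ countF (f ∘ suc))
    head-term true = ≈-refl
    head-term false = +-identityˡ _

  ∑-fibres : ∀ {n k} (h : Fin n → Fin k) (g : Fin k → Carrier) →
             ∑ (λ x → g (h x)) ≈ ∑ (λ p → g p * nat (countF (λ x → ⌊ h x ≟ p ⌋)))
  ∑-fibres h g = begin
    ∑ (λ x → g (h x))                     ≈⟨ ∑-cong (λ x → sym (∑-pickʳ g (h x))) ⟩
    ∑ (λ x → ∑ (λ p → g p * δ (h x) p))   ≈⟨ ∑-swap (λ x p → g p * δ (h x) p) ⟩
    ∑ (λ p → ∑ (λ x → g p * δ (h x) p))   ≈⟨ ∑-cong (λ p → sym (∑-*ˡ (g p) (λ x → δ (h x) p))) ⟩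
    ∑ (λ p → g p * ∑ (λ x → δ (h x) p))   ≈⟨ ∑-cong (λ p → *-congˡ (∑-indicator (λ x → ⌊ h x ≟ p ⌋))) ⟩
    ∑ (λ p → g p * nat (countF (λ x → ⌊ h x ≟ p ⌋))) ∎

  ∑-⊙₂ : ∀ {m n} (A B : Mat₂ m n) u y'' →
         ∑ (λ x' → (A ⊙₂ B) u (y'' , x')) ≈ ∑ (λ y' → ∑ (λ z → A u (y' , z) * ∑ (λ x' → B (y' , z) (y'' , x'))))
  ∑-⊙₂ A B u y'' = begin
    ∑ (λ x' → ∑ (λ y' → ∑ (λ z → A u (y' , z) * B (y' , z) (y'' , x'))))
      ≈⟨ ∑-swap (λ x' y' → ∑ (λ z → A u (y' , z) * B (y' , z) (y'' , x'))) ⟩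
    ∑ (λ y' → ∑ (λ x' → ∑ (λ z → A u (y' , z) * B (y' , z) (y'' , x'))))
      ≈⟨ ∑-cong (λ y' → ∑-swap (λ x' z → A u (y' , z) * B (y' , z) (y'' , x'))) ⟩
    ∑ (λ y' → ∑ (λ z → ∑ (λ x' → A u (y' , z) * B (y' , z) (y'' , x'))))
      ≈⟨ ∑-cong (λ y' → ∑-cong (λ z → sym (∑-*ˡ (A u (y' , z)) (λ x' → B (y' , z) (y'' , x'))))) ⟩
    ∑ (λ y' → ∑ (λ z → A u (y' , z) * ∑ (λ x' → B (y' , z) (y'' , x')))) ∎

  -- In a thin scheme σ_{t₁} σ_{t₂} = σ_{t₃} whenever some path u →t₁ v →t₂ w
  -- has rel(u,w) = t₃: the unique t₁-successor y₀ of y is the only middle point.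
  module ThinProduct {m l} (T : Scheme m l) (thin : IsThin T) where
    open ThinFacts T thin
    open SchemeFacts T using (rel-flip)

    σ-product : ∀ {u v w t₁ t₂ t₃} → rel T u v ≡ t₁ → rel T v w ≡ t₂ → rel T u w ≡ t₃ →
                ∀ y y'' → ∑ (λ y' → δ t₁ (rel T y y') * δ t₂ (rel T y' y'')) ≈ δ t₃ (rel T y y'')
    σ-product {u} {v} {w} {t₁} {t₂} {t₃} uv vw uw y y'' = begin
      ∑ (λ y' → δ t₁ (rel T y y') * δ t₂ (rel T y' y'')) ≈⟨ ∑-cong {m} (λ y' → *-congʳ (reflexive (δ-iff to-y₀ from-y₀))) ⟩
      ∑ (λ y' → δ y₀ y' * δ t₂ (rel T y' y''))           ≈⟨ ∑-pickˡ _ y₀ ⟩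
      δ t₂ (rel T y₀ y'')                                ≡⟨ δ-iff forward backward ⟩
      δ t₃ (rel T y y'') ∎
      where
      y₀ : Fin m
      y₀ = proj₁ (successor y t₁)
      yy₀ : rel T y y₀ ≡ rel T u v
      yy₀ = ≡.trans (proj₂ (successor y t₁)) (≡.sym uv)
      to-y₀ : ∀ {y'} → t₁ ≡ rel T y y' → y₀ ≡ y'
      to-y₀ e = successor-unique (≡.trans (proj₂ (successor y t₁)) e)
      from-y₀ : ∀ {y'} → y₀ ≡ y' → t₁ ≡ rel T y y'
      from-y₀ refl = ≡.sym (proj₂ (successor y t₁))
      y₀y : rel T y₀ y ≡ rel T v u
      y₀y = ≡.trans (rel-flip y y₀) (≡.trans (cong (star T) yy₀) (≡.sym (rel-flip u v)))
      forward : t₂ ≡ rel T y₀ y'' → t₃ ≡ rel T y y''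
      forward e = ≡.trans (≡.sym uw) (path-rel (≡.sym yy₀) (≡.trans vw e))
      backward : t₃ ≡ rel T y y'' → t₂ ≡ rel T y₀ y''
      backward e = ≡.trans (≡.sym vw) (path-rel (≡.sym y₀y) (≡.trans uw e))

module Comodule {c ℓ : Level} (R : CommutativeRing c ℓ) {n k m l : ℕ}
                (S : Scheme n k) (T : Scheme m l) (thin : IsThin T) (φ : Morphism S T) where
  open CommutativeRing R hiding (zero; refl)
  open OverRing R
  open RingFacts R
  open ThinProduct T thin
  open SchemeFacts S using (valency-at)
  open CommSemigroupProperties *-commutativeSemigroup using (interchange; x∙yz≈x∙zy)
  open import Relation.Binary.Reasoning.Setoid setoid

  -- Φ((y,x),(y',x')) = [φ(rel(x,x')) = rel(y,y')]; the matrix of ρ_S(c) is,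
  -- by definition, Φ((y,x),(y',x')) · c(rel(x,x')).
  Φ : Mat₂ m n
  Φ (y , x) (y' , x') = δ (mapS φ (rel S x x')) (rel T y y')

  Φ-path : ∀ x z x' y y'' → ∑ (λ y' → Φ (y , x) (y' , z) * Φ (y' , z) (y'' , x')) ≈ Φ (y , x) (y'' , x')
  Φ-path x z x' = σ-product (hom φ x z) (hom φ z x') (hom φ x x')

  Φ-diagonal : ∀ x y y' → Φ (y , x) (y' , x) ≡ δ y y'
  Φ-diagonal x y y' = δ-iff (λ e → proj₁ (one-spec T y y') (≡.trans (≡.sym e) φ1))
                            (λ e → ≡.trans φ1 (≡.sym (proj₂ (one-spec T y y') e)))
    where
    φ1 : mapS φ (rel S x x) ≡ one T
    φ1 = ≡.trans (≡.sym (hom φ x x)) (proj₂ (one-spec T _ _) refl)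

  -- ρ_S is multiplicative: after exchanging sums, Φ-path collapses the sum
  -- over the Y-coordinate, leaving the product in A(S).
  ρ-mul : ∀ c₁ c₂ c₃ → (mat S c₁ ⊙ mat S c₂) ≈M mat S c₃ →
          (mat₂ T S (ρ φ c₁) ⊙₂ mat₂ T S (ρ φ c₂)) ≈M₂ mat₂ T S (ρ φ c₃)
  ρ-mul c₁ c₂ c₃ prod (y , x) (y'' , x') = begin
    ∑ (λ y' → ∑ (λ z → (Φ (y , x) (y' , z) * C₁ z) * (Φ (y' , z) (y'' , x') * C₂ z)))
      ≈⟨ ∑-swap (λ y' z → (Φ (y , x) (y' , z) * C₁ z) * (Φ (y' , z) (y'' , x') * C₂ z)) ⟩
    ∑ (λ z → ∑ (λ y' → (Φ (y , x) (y' , z) * C₁ z) * (Φ (y' , z) (y'' , x') * C₂ z)))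
      ≈⟨ ∑-cong {n} (λ z → ∑-cong {m} (λ y' → interchange _ _ _ _)) ⟩
    ∑ (λ z → ∑ (λ y' → (Φ (y , x) (y' , z) * Φ (y' , z) (y'' , x')) * (C₁ z * C₂ z)))
      ≈⟨ ∑-cong (λ z → sym (∑-*ʳ (C₁ z * C₂ z) (λ y' → Φ (y , x) (y' , z) * Φ (y' , z) (y'' , x')))) ⟩
    ∑ (λ z → ∑ (λ y' → Φ (y , x) (y' , z) * Φ (y' , z) (y'' , x')) * (C₁ z * C₂ z))
      ≈⟨ ∑-cong (λ z → *-congʳ (Φ-path x z x' y y'')) ⟩
    ∑ (λ z → Φ (y , x) (y'' , x') * (C₁ z * C₂ z))
      ≈⟨ sym (∑-*ˡ (Φ (y , x) (y'' , x')) (λ z → C₁ z * C₂ z)) ⟩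
    Φ (y , x) (y'' , x') * ∑ (λ z → C₁ z * C₂ z)
      ≈⟨ *-congˡ (prod x x') ⟩
    Φ (y , x) (y'' , x') * c₃ (rel S x x') ∎
    where
    C₁ C₂ : Fin n → Carrier
    C₁ z = c₁ (rel S x z)
    C₂ z = c₂ (rel S z x')

  -- ρ_S is unital: off the diagonal of X both sides vanish, on it use Φ-diagonal.
  ρ-unit : ∀ e → mat S e ≈M idMat → mat₂ T S (ρ φ e) ≈M₂ idMat₂
  ρ-unit e unit (y , x) (y' , x') = trans (*-congˡ (unit x x')) (diagonal (x ≟ x'))
    where
    diagonal : Dec (x ≡ x') → Φ (y , x) (y' , x') * δ x x' ≈ δ y y' * δ x x'
    diagonal (yes refl) = *-congʳ (reflexive (Φ-diagonal x y y'))
    diagonal (no x≢x') = trans (*-congˡ (reflexive (δ-diff x≢x')))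
                           (trans (zeroʳ _) (sym (trans (*-congˡ (reflexive (δ-diff x≢x'))) (zeroʳ _))))

  -- Each entry of ε_S(c) is a row sum of the matrix of ρ_S(c), at any base
  -- point x: group the x' by p = rel(x,x'); the fibre of p has n_p elements.
  ε-row : ∀ c₀ x y y'' → mat T (ε φ c₀) y y'' ≈ ∑ (λ x' → mat₂ T S (ρ φ c₀) (y , x) (y'' , x'))
  ε-row c₀ x y y'' = begin
    ∑ (λ p → δ (mapS φ p) t * (nat (valency S p) * c₀ p))
      ≈⟨ ∑-cong (λ p → trans (x∙yz≈x∙zy (δ (mapS φ p) t) _ (c₀ p)) (sym (*-assoc _ (c₀ p) _))) ⟩
    ∑ (λ p → G p * nat (valency S p))
      ≈⟨ ∑-cong (λ p → *-congˡ (reflexive (cong nat (valency-at x p)))) ⟨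
    ∑ (λ p → G p * nat (countF (λ x' → ⌊ rel S x x' ≟ p ⌋)))
      ≈⟨ ∑-fibres (rel S x) G ⟨
    ∑ (λ x' → G (rel S x x')) ∎
    where
    t : Fin l
    t = rel T y y''
    G : Fin k → Carrier
    G p = δ (mapS φ p) t * c₀ p

  -- Any point of X can serve as base point in ε-row; we fix one.
  x₀ : Fin n
  x₀ = proj₁ (nonempty S (one S))

  -- ε_S is multiplicative because, by ε-row, it sums rows of ρ_S, which is.
  ε-mul : ∀ c₁ c₂ c₃ → (mat S c₁ ⊙ mat S c₂) ≈M mat S c₃ →
          (mat T (ε φ c₁) ⊙ mat T (ε φ c₂)) ≈M mat T (ε φ c₃)
  ε-mul c₁ c₂ c₃ prod y y'' = begin
    ∑ (λ y' → mat T (ε φ c₁) y y' * mat T (ε φ c₂) y' y'')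
      ≈⟨ ∑-cong (λ y' → *-congʳ (ε-row c₁ x₀ y y')) ⟩
    ∑ (λ y' → ∑ (λ z → P₁ (y , x₀) (y' , z)) * mat T (ε φ c₂) y' y'')
      ≈⟨ ∑-cong (λ y' → ∑-*ʳ (mat T (ε φ c₂) y' y'') (λ z → P₁ (y , x₀) (y' , z))) ⟩
    ∑ (λ y' → ∑ (λ z → P₁ (y , x₀) (y' , z) * mat T (ε φ c₂) y' y''))
      ≈⟨ ∑-cong (λ y' → ∑-cong (λ z → *-congˡ (ε-row c₂ z y' y''))) ⟩
    ∑ (λ y' → ∑ (λ z → P₁ (y , x₀) (y' , z) * ∑ (λ x' → P₂ (y' , z) (y'' , x'))))
      ≈⟨ ∑-⊙₂ P₁ P₂ (y , x₀) y'' ⟨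
    ∑ (λ x' → (P₁ ⊙₂ P₂) (y , x₀) (y'' , x'))
      ≈⟨ ∑-cong (λ x' → ρ-mul c₁ c₂ c₃ prod (y , x₀) (y'' , x')) ⟩
    ∑ (λ x' → mat₂ T S (ρ φ c₃) (y , x₀) (y'' , x'))
      ≈⟨ ε-row c₃ x₀ y y'' ⟨
    mat T (ε φ c₃) y y'' ∎
    where
    P₁ P₂ : Mat₂ m n
    P₁ = mat₂ T S (ρ φ c₁)
    P₂ = mat₂ T S (ρ φ c₂)

  ε-unit : ∀ e → mat S e ≈M idMat → mat T (ε φ e) ≈M idMat
  ε-unit e unit y y' = begin
    mat T (ε φ e) y y'                              ≈⟨ ε-row e x₀ y y' ⟩
    ∑ (λ x' → mat₂ T S (ρ φ e) (y , x₀) (y' , x'))  ≈⟨ ∑-cong (λ x' → ρ-unit e unit (y , x₀) (y' , x')) ⟩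
    ∑ (λ x' → δ y y' * δ x₀ x')                     ≈⟨ ∑-pickʳ (λ _ → δ y y') x₀ ⟩
    δ y y'                                          ∎

  -- Coassociativity: both sides vanish unless φ(p) = t, and then both equal δ_{tt'} e_p.
  ρ-coassoc : ∀ e t t' p → id⊗ρ φ (ρ φ e) t t' p ≈ Δ⊗id {T = T} {S = S} (ρ φ e) t t' p
  ρ-coassoc e t t' p = by-cases (mapS φ p ≟ t)
    where
    by-cases : Dec (mapS φ p ≡ t) → (δ (mapS φ p) t * e p) * δ (mapS φ p) t' ≈ δ t t' * (δ (mapS φ p) t * e p)
    by-cases (yes refl) = *-comm _ _
    by-cases (no φp≢t) = trans (trans (*-congʳ vanish) (zeroˡ _)) (sym (trans (*-congˡ vanish) (zeroʳ _)))
      where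
      vanish : δ (mapS φ p) t * e p ≈ 0#
      vanish = trans (*-congʳ (reflexive (δ-diff φp≢t))) (zeroˡ _)

  ρ-counit : ∀ e p → εT⊗id {T = T} {S = S} (ρ φ e) p ≈ e p
  ρ-counit e p = ∑-pickˡ (λ _ → e p) (mapS φ p)

proposition8p4 : ∀ {c ℓ : Level} (R : CommutativeRing c ℓ) {n k m l : ℕ}
                   (S : Scheme n k) (T : Scheme m l) → IsThin T → (φ : Morphism S T) →
                   OverRing.IsAlgHom R S T (OverRing.ε R φ) × OverRing.IsComoduleAlgebra R φ
proposition8p4 R S T thin φ = (ε-mul , ε-unit) , (ρ-mul , ρ-unit) , ρ-coassoc , ρ-counit
  where
  open Comodule R S T thin φ
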